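{- Let $n,k,t$ be positive integers with $1\leq k\leq n$. If $n<kt$, then $ar_{tr}(U_{k,n},t)=n$. Otherwise, $ar_{tr}(U_{k,n},t)=t(k-1)$.
   Context: $U_{k,n}$ is the uniform matroid on ground set $[n]=\{1,\dots,n\}$ whose bases are exactly the $k$-element subsets of $[n]$. Given a coloring of $[n]$, a rainbow basis is a basis whose elements have pairwise distinct colors. $ar_{tr}(U_{k,n},t)$ is the maximum number $m$ such that there is a coloring of $[n]$ using exactly $m$ colors with no $t$ pairwise disjoint rainbow bases. -}

module Defs where

open import Data.Nat using (ℕ; zero; _≤_; _<_; _*_; _∸_)
open import Data.Fin using (Fin)
open import Data.Fin.Subset using (Subset; _∈_; ∣_∣)
open import Data.Product using (Σ; ∃; _×_)
open import Data.Sum using (_⊎_)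
open import Data.Empty using (⊥)
open import Relation.Nullary using (¬_)
open import Relation.Binary.PropositionalEquality using (_≡_; _≢_)

record Coloring (n m : ℕ) : Set where
  field
    colour     : Fin n → Fin m
    surjective : ∀ (y : Fin m) → ∃ λ (x : Fin n) → colour x ≡ y
open Coloring public

-- Bases of the uniform matroid U_{k,n}: the k-element subsets of [n].
IsBasis : (k n : ℕ) → Subset n → Set
IsBasis k n B = ∣ B ∣ ≡ k

IsRainbow : {n m : ℕ} → Coloring n m → Subset n → Set
IsRainbow c B = ∀ x y → x ∈ B → y ∈ B → colour c x ≡ colour c y → x ≡ y

IsRainbowBasis : (k : ℕ) {n m : ℕ} → Coloring n m → Subset n → Set
IsRainbowBasis k {n} c B = IsBasis k n B × IsRainbow c B

Disjoint : {n : ℕ} → Subset n → Subset n → Set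
Disjoint A B = ∀ x → x ∈ A → x ∈ B → ⊥

HasDisjointRainbowBases : (k t : ℕ) {n m : ℕ} → Coloring n m → Set
HasDisjointRainbowBases k t {n} c =
  Σ (Fin t → Subset n) λ B →
    (∀ i → IsRainbowBasis k c (B i)) × (∀ i j → i ≢ j → Disjoint (B i) (B j))

Attainable : (k n t m : ℕ) → Set
Attainable k n t m = Σ (Coloring n m) λ c → ¬ HasDisjointRainbowBases k t c

-- a = ar_tr(U_{k,n}, t): the maximum of the attainable values
-- (with the convention max ∅ = 0).
IsArTr : (k n t a : ℕ) → Set
IsArTr k n t a =
  (Attainable k n t a ⊎ (a ≡ 0 × (∀ m → ¬ Attainable k n t m)))
  × (∀ m → Attainable k n t m → m ≤ a)

-- Upper bounds come from counting: t disjoint k-sets need kt ≤ n elements, and if all elements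
-- outside a set S share one colour, every rainbow k-set has k − 1 elements in S, so t disjoint
-- ones need t(k − 1) ≤ |S|.  Colouring x ↦ min(x, t(k − 1) − 1) thus uses t(k − 1) colours and
-- admits no t disjoint rainbow bases.  Conversely, given m > t(k − 1) colours and kt ≤ n, list
-- the colour classes one after another, each cut down to its first t elements.  This list has at
-- least kt entries (a class of size ≥ t contributes t and every other class at least 1; if no
-- class is cut, the list is all of [n]), and a block of ≤ t consecutive entries meets each
-- residue class of positions mod t at most once, so the entries in positions ≡ i (mod t) are
-- rainbow; their first k entries, for i < t, are t disjoint rainbow bases.
module Submission where

open import Defs
open import Data.Nat using (>-nonZero⁻¹; ℕ; zero; suc; _+_; _*_; _∸_; _≤_; _<_; _⊓_; _≤?_; z≤n; s≤s; s≤s⁻¹)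
open import Data.Nat.Properties
open import Data.Fin using (Fin; zero; suc; toℕ; fromℕ<)
open import Data.Fin.Properties using (nonZeroIndex; toℕ-injective; toℕ<n; toℕ-fromℕ<; injective⇒≤; any?)
  renaming (_≟_ to _≟ᶠ_; suc-injective to Fin-suc-injective)
open import Data.Fin.Subset using (Subset; inside; outside; ⊤; ⁅_⁆; _∪_; _∩_; ∁; _⊆_; ∣_∣)
  renaming (_∈_ to _∈ₛ_; _∉_ to _∉ₛ_; ⊥ to ∅)
open import Data.Fin.Subset.Properties
  using (∈⊤; ∉⊥; ∣⊤∣≡n; ∣⊥∣≡0; ∣⁅x⁆∣≡1; x∈⁅x⁆; x∈⁅y⁆⇒x≡y; x∈p∪q⁺; x∈p∪q⁻; ∪-identityˡ;
         x∈p∩q⁺; x∈p∩q⁻; x∈∁p⇒x∉p; x∉p⇒x∈∁p; p⊆q⇒∣p∣≤∣q∣; nonempty?; Empty-unique)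
open import Data.Vec using ([]; _∷_; here; there)
open import Data.List using (List; []; _∷_; _++_; map; take; filter; length; allFin; concatMap)
open import Data.List.Membership.Propositional using (_∈_)
open import Data.List.Membership.Propositional.Properties
  using (∈-allFin; ∈-map⁺; ∈-map⁻; ∈-filter⁺; ∈-filter⁻; ∈-++⁻; ∈-concat⁺′)
open import Data.List.Relation.Unary.Any using (here; there)
open import Data.List.Relation.Unary.All using ([])
  renaming (lookup to All-lookup)
open import Data.List.Relation.Unary.AllPairs using ([]; _∷_)
open import Data.List.Relation.Binary.Sublist.Propositional using () renaming (lookup to ⊆-lookup)
open import Data.List.Relation.Binary.Sublist.Propositional.Properties using (take-⊆)
open import Data.List.Relation.Unary.Unique.Propositional using (Unique)
open import Data.List.Relation.Unary.Unique.Propositional.Properties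
  using (++⁺; take⁺; filter⁺; allFin⁺; map⁻)
open import Data.List.Properties using (length-take; take-all; length-++; length-map; length-tabulate; map-++)
open import Data.Product using (∃-syntax; _×_; _,_; proj₁; proj₂)
open import Data.Sum using (inj₁; inj₂)
open import Data.Empty using (⊥; ⊥-elim)
open import Function using (_∘_)
open import Relation.Nullary using (¬_; yes; no)
open import Relation.Binary.PropositionalEquality

∣p∣≡∣p∩q∣+∣p∩∁q∣ : ∀ {n} (p q : Subset n) → ∣ p ∣ ≡ ∣ p ∩ q ∣ + ∣ p ∩ ∁ q ∣
∣p∣≡∣p∩q∣+∣p∩∁q∣ []            []            = refl
∣p∣≡∣p∩q∣+∣p∩∁q∣ (inside  ∷ p) (inside  ∷ q) = cong suc (∣p∣≡∣p∩q∣+∣p∩∁q∣ p q)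
∣p∣≡∣p∩q∣+∣p∩∁q∣ (inside  ∷ p) (outside ∷ q) =
  trans (cong suc (∣p∣≡∣p∩q∣+∣p∩∁q∣ p q)) (sym (+-suc _ _))
∣p∣≡∣p∩q∣+∣p∩∁q∣ (outside ∷ p) (inside  ∷ q) = ∣p∣≡∣p∩q∣+∣p∩∁q∣ p q
∣p∣≡∣p∩q∣+∣p∩∁q∣ (outside ∷ p) (outside ∷ q) = ∣p∣≡∣p∩q∣+∣p∩∁q∣ p q

∣p∣≤1 : ∀ {n} (p : Subset n) → (∀ {x y} → x ∈ₛ p → y ∈ₛ p → x ≡ y) → ∣ p ∣ ≤ 1
∣p∣≤1 {n} p all-equal with nonempty? p
... | yes (x , x∈p) = subst (∣ p ∣ ≤_) (∣⁅x⁆∣≡1 x) (p⊆q⇒∣p∣≤∣q∣ p⊆⁅x⁆)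
  where
  p⊆⁅x⁆ : p ⊆ ⁅ x ⁆
  p⊆⁅x⁆ y∈p = subst (_∈ₛ ⁅ x ⁆) (all-equal x∈p y∈p) (x∈⁅x⁆ x)
... | no p-empty = subst (λ q → ∣ q ∣ ≤ 1) (sym (Empty-unique p-empty)) (subst (_≤ 1) (sym (∣⊥∣≡0 n)) z≤n)

disjoint-family-bound : ∀ {n t a} (G : Fin t → Subset n) (S : Subset n) →
  (∀ i j → i ≢ j → Disjoint (G i) (G j)) → (∀ i → G i ⊆ S) → (∀ i → a ≤ ∣ G i ∣) →
  t * a ≤ ∣ S ∣
disjoint-family-bound {t = zero} G S disjoint G⊆S a≤ = z≤n
disjoint-family-bound {t = suc t} {a} G S disjoint G⊆S a≤ = begin
  a + t * a                            ≤⟨ +-mono-≤ (a≤ zero) rest-bound ⟩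
  ∣ G zero ∣ + ∣ S ∩ ∁ (G zero) ∣      ≤⟨ +-monoˡ-≤ _ (p⊆q⇒∣p∣≤∣q∣ G₀⊆S∩G₀) ⟩
  ∣ S ∩ G zero ∣ + ∣ S ∩ ∁ (G zero) ∣  ≡⟨ ∣p∣≡∣p∩q∣+∣p∩∁q∣ S (G zero) ⟨
  ∣ S ∣                                ∎
  where
  open ≤-Reasoning
  G₀⊆S∩G₀ : G zero ⊆ S ∩ G zero
  G₀⊆S∩G₀ x∈G₀ = x∈p∩q⁺ (G⊆S zero x∈G₀ , x∈G₀)
  rest⊆ : ∀ i → G (suc i) ⊆ S ∩ ∁ (G zero)
  rest⊆ i {x} x∈Gᵢ =
    x∈p∩q⁺ (G⊆S (suc i) x∈Gᵢ , x∉p⇒x∈∁p (λ x∈G₀ → disjoint zero (suc i) (λ ()) x x∈G₀ x∈Gᵢ))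
  rest-bound : t * a ≤ ∣ S ∩ ∁ (G zero) ∣
  rest-bound = disjoint-family-bound (G ∘ suc) (S ∩ ∁ (G zero))
    (λ i j i≢j → disjoint (suc i) (suc j) (i≢j ∘ Fin-suc-injective)) rest⊆ (a≤ ∘ suc)

disjoint-bases-bound : ∀ {k t n m} (c : Coloring n m) → HasDisjointRainbowBases k t c → t * k ≤ n
disjoint-bases-bound {k} {t} {n} c (B , bases , disjoint) =
  subst (t * k ≤_) (∣⊤∣≡n n)
    (disjoint-family-bound B ⊤ disjoint (λ _ _ → ∈⊤) (≤-reflexive ∘ sym ∘ proj₁ ∘ bases))

module _ {n m : ℕ} (c : Coloring n m) (S : Subset n)
         (monochromatic-outside : ∀ {x y} → x ∈ₛ ∁ S → y ∈ₛ ∁ S → colour c x ≡ colour c y) where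

  rainbow-basis⇒k≤∣B∩S∣ : ∀ {k B} → IsRainbowBasis (suc k) c B → k ≤ ∣ B ∩ S ∣
  rainbow-basis⇒k≤∣B∩S∣ {k} {B} (∣B∣≡1+k , rainbow) = s≤s⁻¹ (begin
    suc k                         ≡⟨ ∣B∣≡1+k ⟨
    ∣ B ∣                         ≡⟨ ∣p∣≡∣p∩q∣+∣p∩∁q∣ B S ⟩
    ∣ B ∩ S ∣ + ∣ B ∩ ∁ S ∣       ≤⟨ +-monoʳ-≤ ∣ B ∩ S ∣ (∣p∣≤1 (B ∩ ∁ S) all-equal) ⟩
    ∣ B ∩ S ∣ + 1                 ≡⟨ +-comm ∣ B ∩ S ∣ 1 ⟩
    suc ∣ B ∩ S ∣                 ∎)
    where
    open ≤-Reasoning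
    all-equal : ∀ {x y} → x ∈ₛ B ∩ ∁ S → y ∈ₛ B ∩ ∁ S → x ≡ y
    all-equal {x} {y} x∈ y∈ =
      let x∈B , x∉S = x∈p∩q⁻ B (∁ S) x∈
          y∈B , y∉S = x∈p∩q⁻ B (∁ S) y∈
      in rainbow x y x∈B y∈B (monochromatic-outside x∉S y∉S)

  disjoint-rainbow-bases-bound : ∀ {k t} → HasDisjointRainbowBases (suc k) t c → t * k ≤ ∣ S ∣
  disjoint-rainbow-bases-bound (B , bases , disjoint) =
    disjoint-family-bound (λ i → B i ∩ S) S
      (λ i j i≢j x x∈Bᵢ x∈Bⱼ →
        disjoint i j i≢j x (proj₁ (x∈p∩q⁻ (B i) S x∈Bᵢ)) (proj₁ (x∈p∩q⁻ (B j) S x∈Bⱼ)))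
      (λ i x∈ → proj₂ (x∈p∩q⁻ (B i) S x∈))
      (rainbow-basis⇒k≤∣B∩S∣ ∘ bases)

initial : ℕ → ∀ {n} → Subset n
initial zero          = ∅
initial (suc a) {zero}  = []
initial (suc a) {suc n} = inside ∷ initial a

∣initial∣≤ : ∀ a {n} → ∣ initial a {n} ∣ ≤ a
∣initial∣≤ zero    {n}     = ≤-reflexive (∣⊥∣≡0 n)
∣initial∣≤ (suc a) {zero}  = z≤n
∣initial∣≤ (suc a) {suc n} = s≤s (∣initial∣≤ a)

∉initial⇒≥ : ∀ a {n} {x : Fin n} → x ∉ₛ initial a → a ≤ toℕ x
∉initial⇒≥ zero    x∉ = z≤n
∉initial⇒≥ (suc a) {x = zero}  x∉ = ⊥-elim (x∉ here)
∉initial⇒≥ (suc a) {x = suc x} x∉ = s≤s (∉initial⇒≥ a (x∉ ∘ there))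

identity-colouring : ∀ n → Coloring n n
identity-colouring n = record { colour = λ x → x ; surjective = λ y → y , refl }

colours≤elements : ∀ {n m} → Coloring n m → m ≤ n
colours≤elements c = injective⇒≤ {f = proj₁ ∘ surjective c} λ {y} {y′} eq →
  trans (sym (proj₂ (surjective c y))) (trans (cong (colour c) eq) (proj₂ (surjective c y′)))

clamp : ∀ {n} a → a < n → Coloring n (suc a)
clamp {n} a a<n = record { colour = clamped ; surjective = surjective′ }
  where
  clamped : Fin n → Fin (suc a)
  clamped x = fromℕ< (s≤s (m⊓n≤n (toℕ x) a))
  surjective′ : ∀ y → ∃[ x ] clamped x ≡ y
  surjective′ y = fromℕ< (≤-trans (toℕ<n y) a<n) , toℕ-injective (begin
    toℕ (clamped _)      ≡⟨ toℕ-fromℕ< _ ⟩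
    toℕ (fromℕ< _) ⊓ a   ≡⟨ cong (_⊓ a) (toℕ-fromℕ< _) ⟩
    toℕ y ⊓ a            ≡⟨ m≤n⇒m⊓n≡m (s≤s⁻¹ (toℕ<n y)) ⟩
    toℕ y                ∎)
    where open ≡-Reasoning

clamp-no-rainbow-bases : ∀ {n k t} a (a<n : a < n) → a < t * k →
  ¬ HasDisjointRainbowBases (suc k) t (clamp a a<n)
clamp-no-rainbow-bases {n} {k} {t} a a<n a<tk bases =
  <⇒≱ a<tk (≤-trans (disjoint-rainbow-bases-bound (clamp a a<n) (initial a) same-colour bases)
                     (∣initial∣≤ a))
  where
  colour-a : ∀ {x} → x ∈ₛ ∁ (initial a) → toℕ (colour (clamp a a<n) x) ≡ a
  colour-a {x} x∉ = trans (toℕ-fromℕ< _) (m≥n⇒m⊓n≡n (∉initial⇒≥ a (x∈∁p⇒x∉p x∉)))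
  same-colour : ∀ {x y} → x ∈ₛ ∁ (initial a) → y ∈ₛ ∁ (initial a) →
                colour (clamp a a<n) x ≡ colour (clamp a a<n) y
  same-colour x∉ y∉ = toℕ-injective (trans (colour-a x∉) (sym (colour-a y∉)))

module _ {A : Set} (t′ : ℕ) where

  -- The entries of xs at positions φ, φ + 1 + t′, φ + 2 (1 + t′), …
  stride : ℕ → List A → List A
  stride φ       []       = []
  stride zero    (x ∷ xs) = x ∷ stride t′ xs
  stride (suc φ) (x ∷ xs) = stride φ xs

  stride-⊆ : ∀ φ xs {x} → x ∈ stride φ xs → x ∈ xs
  stride-⊆ zero    (y ∷ ys) (here x≡y) = here x≡y
  stride-⊆ zero    (y ∷ ys) (there x∈) = there (stride-⊆ t′ ys x∈)
  stride-⊆ (suc φ) (y ∷ ys) x∈         = there (stride-⊆ φ ys x∈)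

  stride-disjoint : ∀ {xs} → Unique xs → ∀ {φ ψ} → φ ≤ t′ → ψ ≤ t′ → φ ≢ ψ →
                    ∀ {x} → x ∈ stride φ xs → x ∈ stride ψ xs → ⊥
  stride-disjoint {y ∷ ys} _          {zero}  {zero}  _   _   φ≢ψ _ _ = φ≢ψ refl
  stride-disjoint {y ∷ ys} (y∉ys ∷ _) {zero}  {suc ψ} _   _   _ (here refl) x∈ψ =
    All-lookup y∉ys (stride-⊆ ψ ys x∈ψ) refl
  stride-disjoint {y ∷ ys} (_ ∷ ys!)  {zero}  {suc ψ} _   ψ<t′ _ (there x∈φ) x∈ψ =
    stride-disjoint ys! ≤-refl (<⇒≤ ψ<t′) (<⇒≢ ψ<t′ ∘ sym) x∈φ x∈ψ
  stride-disjoint {y ∷ ys} (y∉ys ∷ _) {suc φ} {zero}  _   _   _ x∈φ (here refl) =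
    All-lookup y∉ys (stride-⊆ φ ys x∈φ) refl
  stride-disjoint {y ∷ ys} (_ ∷ ys!)  {suc φ} {zero}  φ<t′ _  _ x∈φ (there x∈ψ) =
    stride-disjoint ys! (<⇒≤ φ<t′) ≤-refl (<⇒≢ φ<t′) x∈φ x∈ψ
  stride-disjoint {y ∷ ys} (_ ∷ ys!)  {suc φ} {suc ψ} φ<t′ ψ<t′ φ≢ψ x∈φ x∈ψ =
    stride-disjoint ys! (<⇒≤ φ<t′) (<⇒≤ ψ<t′) (φ≢ψ ∘ cong suc) x∈φ x∈ψ

  length-stride : ∀ xs φ k → φ ≤ t′ → φ + k * suc t′ < length xs → k < length (stride φ xs)
  length-stride (y ∷ ys) zero    zero    _   _ = s≤s z≤n
  length-stride (y ∷ ys) zero    (suc k) _   bound = s≤s (length-stride ys t′ k ≤-refl (s≤s⁻¹ bound))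
  length-stride (y ∷ ys) (suc φ) k       φ<t′ bound = length-stride ys φ k (<⇒≤ φ<t′) (s≤s⁻¹ bound)

  stride-skip-++ : ∀ φ (xs ys : List A) → length xs ≤ φ → stride φ (xs ++ ys) ≡ stride (φ ∸ length xs) ys
  stride-skip-++ φ       []       ys _   = refl
  stride-skip-++ (suc φ) (x ∷ xs) ys len = stride-skip-++ φ xs ys (s≤s⁻¹ len)

  stride-++-short : ∀ φ (xs ys : List A) → φ ≤ t′ → length xs ≤ suc t′ →
    ∃[ ψ ] ∃[ s ] ψ ≤ t′ × length s ≤ 1 × (∀ {x} → x ∈ s → x ∈ xs) × stride φ (xs ++ ys) ≡ s ++ stride ψ ys
  stride-++-short φ [] ys φ≤t′ _ = φ , [] , φ≤t′ , z≤n , (λ ()) , refl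
  stride-++-short zero (x ∷ xs) ys _ len =
    t′ ∸ length xs , x ∷ [] , m∸n≤m t′ (length xs) , ≤-refl , (λ { (here refl) → here refl }) ,
    cong (x ∷_) (stride-skip-++ t′ xs ys (s≤s⁻¹ len))
  stride-++-short (suc φ) (x ∷ xs) ys φ<t′ len
    with ψ , s , ψ≤t′ , ∣s∣≤1 , s⊆xs , eq ← stride-++-short φ xs ys (<⇒≤ φ<t′) (m≤n⇒m≤1+n (s≤s⁻¹ len))
    = ψ , s , ψ≤t′ , ∣s∣≤1 , there ∘ s⊆xs , eq

length≤1⇒Unique : ∀ {A : Set} (xs : List A) → length xs ≤ 1 → Unique xs
length≤1⇒Unique []          _ = []
length≤1⇒Unique (x ∷ [])    _ = [] ∷ []
length≤1⇒Unique (x ∷ y ∷ _) (s≤s ())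

Unique-map⇒injective : ∀ {A B : Set} (f : A → B) {xs x y} → Unique (map f xs) →
                       x ∈ xs → y ∈ xs → f x ≡ f y → x ≡ y
Unique-map⇒injective f (_ ∷ _)    (here refl) (here refl) _     = refl
Unique-map⇒injective f (fx∉ ∷ _)  (here refl) (there y∈)  fx≡fy =
  ⊥-elim (All-lookup fx∉ (∈-map⁺ f y∈) fx≡fy)
Unique-map⇒injective f (fy∉ ∷ _)  (there x∈)  (here refl) fx≡fy =
  ⊥-elim (All-lookup fy∉ (∈-map⁺ f x∈) (sym fx≡fy))
Unique-map⇒injective f (_ ∷ fxs!) (there x∈)  (there y∈)  fx≡fy = Unique-map⇒injective f fxs! x∈ y∈ fx≡fy

module _ {A C : Set} (f : A → C) (block : C → List A) (block-colour : ∀ c {x} → x ∈ block c → f x ≡ c) where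

  ∈-concatMap⇒colour∈ : ∀ cs {x} → x ∈ concatMap block cs → f x ∈ cs
  ∈-concatMap⇒colour∈ (c ∷ cs) x∈ with ∈-++⁻ (block c) x∈
  ... | inj₁ x∈c  = here (block-colour c x∈c)
  ... | inj₂ x∈cs = there (∈-concatMap⇒colour∈ cs x∈cs)

  concatMap-Unique : (∀ c → Unique (block c)) → ∀ {cs} → Unique cs → Unique (concatMap block cs)
  concatMap-Unique blocks! {[]}     []            = []
  concatMap-Unique blocks! {c ∷ cs} (c∉cs ∷ cs!) =
    ++⁺ (blocks! c) (concatMap-Unique blocks! cs!)
      (λ (x∈c , x∈cs) → All-lookup c∉cs (∈-concatMap⇒colour∈ cs x∈cs) (sym (block-colour c x∈c)))

  stride-concatMap-rainbow : ∀ t′ → (∀ c → length (block c) ≤ suc t′) → ∀ {cs} → Unique cs →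
                             ∀ φ → φ ≤ t′ → Unique (map f (stride t′ φ (concatMap block cs)))
  stride-concatMap-rainbow t′ short {[]}     []            φ _    = []
  stride-concatMap-rainbow t′ short {c ∷ cs} (c∉cs ∷ cs!) φ φ≤t′
    with ψ , s , ψ≤t′ , ∣s∣≤1 , s⊆c , eq ← stride-++-short t′ φ (block c) (concatMap block cs) φ≤t′ (short c)
    = subst (Unique ∘ map f) (sym eq) (subst Unique (sym (map-++ f s rest))
        (++⁺ (length≤1⇒Unique (map f s) (subst (_≤ 1) (sym (length-map f s)) ∣s∣≤1))
             (stride-concatMap-rainbow t′ short cs! ψ ψ≤t′)
             disjoint))
    where
    rest : List A
    rest = stride t′ ψ (concatMap block cs)
    disjoint : ∀ {v} → ¬ (v ∈ map f s × v ∈ map f rest)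
    disjoint (v∈s , v∈rest) with ∈-map⁻ f v∈s | ∈-map⁻ f v∈rest
    ... | x , x∈s , refl | y , y∈rest , fx≡fy =
      All-lookup c∉cs (subst (_∈ cs) (sym fx≡fy) (∈-concatMap⇒colour∈ cs (stride-⊆ t′ ψ _ y∈rest)))
        (sym (block-colour c (s⊆c x∈s)))

module _ {A C : Set} (block : C → List A) (nonempty : ∀ c → 1 ≤ length (block c)) where

  length≤length-concatMap : ∀ cs → length cs ≤ length (concatMap block cs)
  length≤length-concatMap []       = z≤n
  length≤length-concatMap (c ∷ cs) = subst (suc (length cs) ≤_) (sym (length-++ (block c)))
    (+-mono-≤ (nonempty c) (length≤length-concatMap cs))

  length-block+length≤length-concatMap : ∀ {c} cs → c ∈ cs →
    length (block c) + length cs ≤ suc (length (concatMap block cs))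
  length-block+length≤length-concatMap (c ∷ cs) (here refl) = begin
    length (block c) + suc (length cs)                    ≡⟨ +-suc _ _ ⟩
    suc (length (block c) + length cs)                    ≤⟨ s≤s (+-monoʳ-≤ _ (length≤length-concatMap cs)) ⟩
    suc (length (block c) + length (concatMap block cs))  ≡⟨ cong suc (length-++ (block c)) ⟨
    suc (length (concatMap block (c ∷ cs)))               ∎
    where open ≤-Reasoning
  length-block+length≤length-concatMap {c₀} (c ∷ cs) (there c₀∈cs) = begin
    length (block c₀) + suc (length cs)                   ≡⟨ +-suc _ _ ⟩
    suc (length (block c₀) + length cs)                   ≤⟨ s≤s (length-block+length≤length-concatMap cs c₀∈cs) ⟩
    suc (1 + length (concatMap block cs))                 ≤⟨ s≤s (+-monoˡ-≤ _ (nonempty c)) ⟩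
    suc (length (block c) + length (concatMap block cs))  ≡⟨ cong suc (length-++ (block c)) ⟨
    suc (length (concatMap block (c ∷ cs)))               ∎
    where open ≤-Reasoning

fromList : ∀ {n} → List (Fin n) → Subset n
fromList []       = ∅
fromList (x ∷ xs) = ⁅ x ⁆ ∪ fromList xs

∈-fromList⁻ : ∀ {n} {x : Fin n} xs → x ∈ₛ fromList xs → x ∈ xs
∈-fromList⁻ []       x∈ = ⊥-elim (∉⊥ x∈)
∈-fromList⁻ (y ∷ ys) x∈ with x∈p∪q⁻ ⁅ y ⁆ (fromList ys) x∈
... | inj₁ x∈⁅y⁆ = here (x∈⁅y⁆⇒x≡y y x∈⁅y⁆)
... | inj₂ x∈ys  = there (∈-fromList⁻ ys x∈ys)

∈-fromList⁺ : ∀ {n} {x : Fin n} {xs} → x ∈ xs → x ∈ₛ fromList xs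
∈-fromList⁺ (here refl) = x∈p∪q⁺ (inj₁ (x∈⁅x⁆ _))
∈-fromList⁺ (there x∈)  = x∈p∪q⁺ (inj₂ (∈-fromList⁺ x∈))

∣⁅x⁆∪p∣≡1+∣p∣ : ∀ {n} (x : Fin n) (p : Subset n) → x ∉ₛ p → ∣ ⁅ x ⁆ ∪ p ∣ ≡ suc ∣ p ∣
∣⁅x⁆∪p∣≡1+∣p∣ zero    (outside ∷ p) _   = cong (suc ∘ ∣_∣) (∪-identityˡ p)
∣⁅x⁆∪p∣≡1+∣p∣ zero    (inside  ∷ p) x∉p = ⊥-elim (x∉p here)
∣⁅x⁆∪p∣≡1+∣p∣ (suc x) (outside ∷ p) x∉p = ∣⁅x⁆∪p∣≡1+∣p∣ x p (x∉p ∘ there)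
∣⁅x⁆∪p∣≡1+∣p∣ (suc x) (inside  ∷ p) x∉p = cong suc (∣⁅x⁆∪p∣≡1+∣p∣ x p (x∉p ∘ there))

∣fromList∣≡length : ∀ {n} {xs : List (Fin n)} → Unique xs → ∣ fromList xs ∣ ≡ length xs
∣fromList∣≡length {n} {[]}     []           = ∣⊥∣≡0 n
∣fromList∣≡length {xs = x ∷ xs} (x∉xs ∷ xs!) =
  trans (∣⁅x⁆∪p∣≡1+∣p∣ x (fromList xs) (λ x∈ → All-lookup x∉xs (∈-fromList⁻ xs x∈) refl))
        (cong suc (∣fromList∣≡length xs!))

complete⇒n≤length : ∀ {n} {xs : List (Fin n)} → Unique xs → (∀ x → x ∈ xs) → n ≤ length xs
complete⇒n≤length {n} {xs} xs! complete = begin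
  n                  ≡⟨ ∣⊤∣≡n n ⟨
  ∣ ⊤ {n} ∣          ≤⟨ p⊆q⇒∣p∣≤∣q∣ {p = ⊤} (λ {x} _ → ∈-fromList⁺ (complete x)) ⟩
  ∣ fromList xs ∣    ≡⟨ ∣fromList∣≡length xs! ⟩
  length xs          ∎
  where open ≤-Reasoning

module _ {n m : ℕ} (c : Coloring n m) where

  colourClass : Fin m → List (Fin n)
  colourClass a = filter (λ x → colour c x ≟ᶠ a) (allFin n)

  module _ (t : ℕ) where

    truncatedClass : Fin m → List (Fin n)
    truncatedClass a = take t (colourClass a)

    truncatedClasses : List (Fin n)
    truncatedClasses = concatMap truncatedClass (allFin m)

    truncatedClass-colour : ∀ a {x} → x ∈ truncatedClass a → colour c x ≡ a
    truncatedClass-colour a x∈ =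
      proj₂ (∈-filter⁻ (λ x → colour c x ≟ᶠ a) {xs = allFin n} (⊆-lookup (take-⊆ t (colourClass a)) x∈))

    length-truncatedClass : ∀ a → length (truncatedClass a) ≡ t ⊓ length (colourClass a)
    length-truncatedClass a = length-take t (colourClass a)

    truncatedClasses-Unique : Unique truncatedClasses
    truncatedClasses-Unique = concatMap-Unique (colour c) truncatedClass truncatedClass-colour
      (λ a → take⁺ t (filter⁺ (λ x → colour c x ≟ᶠ a) (allFin⁺ n))) (allFin⁺ m)

length-truncatedClasses≥ : ∀ {n m k t′} (c : Coloring n m) → suc k * suc t′ ≤ n → suc t′ * k < m →
                          suc k * suc t′ ≤ length (truncatedClasses c (suc t′))
length-truncatedClasses≥ {n} {m} {k} {t′} c k+1*t≤n t*k<m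
  with any? (λ a → suc t′ ≤? length (colourClass c a))
... | yes (a , t≤∣a∣) = s≤s⁻¹ (begin
  suc (t + k * t)                   ≡⟨ cong (λ z → suc (t + z)) (*-comm k t) ⟩
  suc (t + t * k)                   ≡⟨ +-suc t (t * k) ⟨
  t + suc (t * k)                   ≤⟨ +-monoʳ-≤ t t*k<m ⟩
  t + m                             ≡⟨ cong₂ _+_ (trans (length-truncatedClass c t a) (m≤n⇒m⊓n≡m t≤∣a∣))
                                                 (length-tabulate (λ x → x)) ⟨
  length (truncatedClass c t a) + length (allFin m)
                                    ≤⟨ length-block+length≤length-concatMap (truncatedClass c t) nonempty
                                         (allFin m) (∈-allFin a) ⟩
  suc (length (truncatedClasses c t)) ∎)
  where
  open ≤-Reasoning
  t = suc t′
  take-nonempty : ∀ {xs : List (Fin n)} {x} → x ∈ xs → 1 ≤ length (take t xs)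
  take-nonempty (here _)  = s≤s z≤n
  take-nonempty (there _) = s≤s z≤n
  nonempty : ∀ b → 1 ≤ length (truncatedClass c t b)
  nonempty b = take-nonempty
    (∈-filter⁺ (λ x → colour c x ≟ᶠ b) (∈-allFin (proj₁ (surjective c b))) (proj₂ (surjective c b)))
... | no none = ≤-trans k+1*t≤n (complete⇒n≤length (truncatedClasses-Unique c t) every-x)
  where
  t = suc t′
  every-x : ∀ x → x ∈ truncatedClasses c t
  every-x x = ∈-concat⁺′ x∈class (∈-map⁺ (truncatedClass c t) (∈-allFin (colour c x)))
    where
    x∈class : x ∈ truncatedClass c t (colour c x)
    x∈class rewrite take-all t (colourClass c (colour c x)) (<⇒≤ (≰⇒> (none ∘ (colour c x ,_)))) =
      ∈-filter⁺ (λ y → colour c y ≟ᶠ colour c x) (∈-allFin x) refl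

rainbow-bases-exist : ∀ {n m k t′} (c : Coloring n m) → suc k * suc t′ ≤ n → suc t′ * k < m →
                      HasDisjointRainbowBases (suc k) (suc t′) c
rainbow-bases-exist {n} {m} {k} {t′} c k+1*t≤n t*k<m = B , (λ i → ∣B∣≡1+k i , rainbow i) , disjoint
  where
  L : List (Fin n)
  L = truncatedClasses c (suc t′)
  row : Fin (suc t′) → List (Fin n)
  row i = stride t′ (toℕ i) L
  B : Fin (suc t′) → Subset n
  B i = fromList (take (suc k) (row i))
  i≤t′ : ∀ (i : Fin (suc t′)) → toℕ i ≤ t′
  i≤t′ i = s≤s⁻¹ (toℕ<n i)
  row-rainbow : ∀ i → Unique (map (colour c) (row i))
  row-rainbow i =
    stride-concatMap-rainbow (colour c) (truncatedClass c (suc t′)) (truncatedClass-colour c (suc t′)) t′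
      (λ a → subst (_≤ suc t′) (sym (length-truncatedClass c (suc t′) a)) (m⊓n≤m _ _))
      (allFin⁺ m) (toℕ i) (i≤t′ i)
  ∈B⇒∈row : ∀ i {x} → x ∈ₛ B i → x ∈ row i
  ∈B⇒∈row i x∈ = ⊆-lookup (take-⊆ (suc k) (row i)) (∈-fromList⁻ _ x∈)
  ∣B∣≡1+k : ∀ i → ∣ B i ∣ ≡ suc k
  ∣B∣≡1+k i = begin
    ∣ B i ∣                         ≡⟨ ∣fromList∣≡length (take⁺ (suc k) (map⁻ (row-rainbow i))) ⟩
    length (take (suc k) (row i))   ≡⟨ length-take (suc k) (row i) ⟩
    suc k ⊓ length (row i)          ≡⟨ m≤n⇒m⊓n≡m (length-stride t′ L (toℕ i) k (i≤t′ i) i+k*t<∣L∣) ⟩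
    suc k                           ∎
    where
    open ≡-Reasoning
    i+k*t<∣L∣ : toℕ i + k * suc t′ < length L
    i+k*t<∣L∣ = ≤-trans (+-monoˡ-≤ (k * suc t′) (toℕ<n i)) (length-truncatedClasses≥ c k+1*t≤n t*k<m)
  rainbow : ∀ i → IsRainbow c (B i)
  rainbow i x y x∈ y∈ = Unique-map⇒injective (colour c) (row-rainbow i) (∈B⇒∈row i x∈) (∈B⇒∈row i y∈)
  disjoint : ∀ i j → i ≢ j → Disjoint (B i) (B j)
  disjoint i j i≢j x x∈Bᵢ x∈Bⱼ = stride-disjoint t′ (truncatedClasses-Unique c (suc t′)) (i≤t′ i) (i≤t′ j)
    (i≢j ∘ toℕ-injective) (∈B⇒∈row i x∈Bᵢ) (∈B⇒∈row j x∈Bⱼ)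

attainable⇒≤ : ∀ {n m k t′} → suc k * suc t′ ≤ n → Attainable (suc k) n (suc t′) m → m ≤ suc t′ * k
attainable⇒≤ k+1*t≤n (c , no-bases) = ≮⇒≥ (no-bases ∘ rainbow-bases-exist c k+1*t≤n)

isArTr-n<kt : ∀ {n k t} → n < k * t → IsArTr k n t n
isArTr-n<kt {n} {k} {t} n<kt =
  inj₁ (identity-colouring n , λ bases →
          <⇒≱ n<kt (subst (_≤ n) (*-comm t k) (disjoint-bases-bound (identity-colouring n) bases))) ,
  λ m (c , _) → colours≤elements c

isArTr-kt≤n : ∀ {n k t′} → suc k * suc t′ ≤ n → IsArTr (suc k) n (suc t′) (suc t′ * k)
isArTr-kt≤n {n} {zero} {t′} t≤n = inj₂ (*-zeroʳ (suc t′) , no-colouring) , λ m → ⊥-elim ∘ no-colouring m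
  where
  no-colouring : ∀ m → ¬ Attainable 1 n (suc t′) m
  no-colouring m (c , no-bases) = no-bases (rainbow-bases-exist c t≤n t*0<m)
    where
    t*0<m : suc t′ * 0 < m
    t*0<m rewrite *-zeroʳ (suc t′) =
      >-nonZero⁻¹ m {{nonZeroIndex (colour c (fromℕ< (≤-trans (s≤s z≤n) t≤n)))}}
isArTr-kt≤n {n} {suc k′} {t′} k+1*t≤n =
  inj₁ (clamp a a<n , clamp-no-rainbow-bases a a<n ≤-refl) , λ m → attainable⇒≤ k+1*t≤n
  where
  -- suc a reduces to suc t′ * suc k′, i.e. t (k − 1).
  a : ℕ
  a = k′ + t′ * suc k′
  a<n : a < n
  a<n = ≤-trans (*-monoʳ-≤ (suc t′) (n≤1+n (suc k′)))
                (subst (_≤ n) (*-comm (suc (suc k′)) (suc t′)) k+1*t≤n)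

theorem18 : (n k t : ℕ) → 1 ≤ k → k ≤ n → 1 ≤ t →
    (n < k * t → IsArTr k n t n) × (¬ (n < k * t) → IsArTr k n t (t * (k ∸ 1)))
theorem18 n (suc k) (suc t′) _ _ _ = isArTr-n<kt , isArTr-kt≤n ∘ ≮⇒≥
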